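{- If the Heyting algebra $\mathfrak{A}$ is countable, then $\overset{\rightarrow}{\mathfrak{A}}$ is countable as well.
   Context: For a Heyting algebra $\mathfrak{B}$, let $\mathcal{S}_{\mathfrak{B}}$ be the poset of prime filters of $\mathfrak{B}$ under inclusion, $H(\mathcal{S}_{\mathfrak{B}})$ the Heyting algebra of upward-closed subsets of $\mathcal{S}_{\mathfrak{B}}$, and $h_{\mathfrak{B}}(x)=\{F\in\mathcal{S}_{\mathfrak{B}}: x\in F\}$ the Stone embedding. For an upward set $X$, $\delta X=\{F: \forall F'\in\mathcal{S}_{\mathfrak{B}}\,(F\subsetneq F'\Rightarrow F'\in X)\}$. $\delta[\mathfrak{B}]$ is the subalgebra of $H(\mathcal{S}_{\mathfrak{B}})$ generated by all $h_{\mathfrak{B}}(x)$ and all $\delta h_{\mathfrak{B}}(x)$, $x\in|\mathfrak{B}|$. Put $\mathfrak{A}_0=\mathfrak{A}$, $\mathfrak{A}_{i+1}=\delta[\mathfrak{A}_i]$, with embeddings $h_{\mathfrak{A}_i}:\mathfrak{A}_i\to\mathfrak{A}_{i+1}$; $\overset{\rightarrow}{\mathfrak{A}}$ is the direct limit of this directed family. -}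

module Defs where

open import Level using (Level; _⊔_; Lift; lift; lower) renaming (suc to lsuc)
open import Data.Nat.Base using (ℕ; zero; suc; _≤′_; ≤′-refl; ≤′-step)
open import Data.Product.Base using (Σ; ∃; _×_; _,_; proj₁; proj₂)
open import Data.Sum.Base using (_⊎_; inj₁; inj₂)
open import Data.Empty using (⊥-elim)
import Data.Empty.Polymorphic as P⊥
import Data.Unit.Polymorphic as P⊤
open import Relation.Nullary using (¬_)
open import Relation.Binary.Lattice.Bundles using (HeytingAlgebra)

-- Countability of a set presented as a setoid (carrier + equality):
-- there is a map from ℕ onto the carrier (up to the given equality).
-- (All sets considered here are inhabited, so this is "countable".)

Countable : ∀ {a r} {A : Set a} → (A → A → Set r) → Set (a ⊔ r)
Countable {A = A} _≈_ = Σ (ℕ → A) λ f → ∀ x → ∃ λ n → f n ≈ x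

module Construction {c ℓ₁ ℓ₂} (ℓ : Level) (B : HeytingAlgebra c ℓ₁ ℓ₂) where
  open HeytingAlgebra B

  L : Level
  L = c ⊔ ℓ₂ ⊔ lsuc ℓ

  record PrimeFilter : Set L where
    field
      mem     : Carrier → Set ℓ
      upward  : ∀ {x y} → x ≤ y → mem x → mem y
      has-⊤   : mem ⊤
      has-∧   : ∀ {x y} → mem x → mem y → mem (x ∧ y)
      proper  : ¬ mem ⊥
      prime   : ∀ {x y} → mem (x ∨ y) → mem x ⊎ mem y
  open PrimeFilter public

  _⊆_ : PrimeFilter → PrimeFilter → Set (c ⊔ ℓ)
  F ⊆ G = ∀ x → mem F x → mem G x

  _⊊_ : PrimeFilter → PrimeFilter → Set (c ⊔ ℓ)
  F ⊊ G = F ⊆ G × ¬ (G ⊆ F)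

  Subset : Set (lsuc L)
  Subset = PrimeFilter → Set L

  IsUpset : Subset → Set L
  IsUpset X = ∀ {F G} → F ⊆ G → X F → X G

  h : Carrier → Subset
  h x F = Lift L (mem F x)

  δ : Subset → Subset
  δ X F = ∀ F′ → F ⊊ F′ → X F′

  _∩_ _∪_ _⇒_ : Subset → Subset → Subset
  (X ∩ Y) F = X F × Y F
  (X ∪ Y) F = X F ⊎ Y F
  (X ⇒ Y) F = ∀ G → F ⊆ G → X G → Y G

  Full Empty : Subset
  Full  _ = P⊤.⊤
  Empty _ = P⊥.⊥

  _⊑_ _≐_ : Subset → Subset → Set L
  X ⊑ Y = ∀ F → X F → Y F
  X ≐ Y = ∀ F → (X F → Y F) × (Y F → X F)

  -- Terms over the generators h(x) (gen x) and δ h(x) (dgen x);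
  -- their interpretations are exactly the elements of δ[B].
  data Term : Set c where
    gen dgen      : Carrier → Term
    top bot       : Term
    _and_ _or_ _imp_ : Term → Term → Term

  ⟦_⟧ : Term → Subset
  ⟦ gen x ⟧   = h x
  ⟦ dgen x ⟧  = δ (h x)
  ⟦ top ⟧     = Full
  ⟦ bot ⟧     = Empty
  ⟦ s and t ⟧ = ⟦ s ⟧ ∩ ⟦ t ⟧
  ⟦ s or t ⟧  = ⟦ s ⟧ ∪ ⟦ t ⟧
  ⟦ s imp t ⟧ = ⟦ s ⟧ ⇒ ⟦ t ⟧

  ⊆-trans : ∀ {F G H} → F ⊆ G → G ⊆ H → F ⊆ H
  ⊆-trans p q x m = q x (p x m)

  ⊆-refl : ∀ {F} → F ⊆ F
  ⊆-refl x m = m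

  ⟦⟧-upset : ∀ t → IsUpset ⟦ t ⟧
  ⟦⟧-upset (gen x)   p (lift m) = lift (p x m)
  ⟦⟧-upset (dgen x)  {F} {G} p d F′ (q , nq) =
    d F′ (⊆-trans {F} {G} {F′} p q , λ r → nq (⊆-trans {F′} {F} {G} r p))
  ⟦⟧-upset top       p _ = _
  ⟦⟧-upset bot       p ()
  ⟦⟧-upset (s and t) p (a , b) = ⟦⟧-upset s p a , ⟦⟧-upset t p b
  ⟦⟧-upset (s or t)  p (inj₁ a) = inj₁ (⟦⟧-upset s p a)
  ⟦⟧-upset (s or t)  p (inj₂ b) = inj₂ (⟦⟧-upset t p b)
  ⟦⟧-upset (s imp t) {F} {F₁} p f G q = f G (⊆-trans {F} {F₁} {G} p q)

  δ[_] : HeytingAlgebra c L L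
  δ[_] = record
    { Carrier = Term
    ; _≈_ = λ s t → ⟦ s ⟧ ≐ ⟦ t ⟧
    ; _≤_ = λ s t → ⟦ s ⟧ ⊑ ⟦ t ⟧
    ; _∨_ = _or_
    ; _∧_ = _and_
    ; _⇨_ = _imp_
    ; ⊤ = top
    ; ⊥ = bot
    ; isHeytingAlgebra = record
      { isBoundedLattice = record
        { isLattice = record
          { isPartialOrder = record
            { isPreorder = record
              { isEquivalence = record
                { refl = λ F → (λ a → a) , (λ a → a)
                ; sym = λ e F → proj₂ (e F) , proj₁ (e F)
                ; trans = λ e e′ F → (λ a → proj₁ (e′ F) (proj₁ (e F) a))
                                   , (λ a → proj₂ (e F) (proj₂ (e′ F) a)) }
              ; reflexive = λ e F → proj₁ (e F)
              ; trans = λ p q F a → q F (p F a) }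
            ; antisym = λ p q F → p F , q F }
          ; supremum = λ x y → (λ F → inj₁) , (λ F → inj₂)
                     , λ z p q F → λ { (inj₁ a) → p F a ; (inj₂ b) → q F b }
          ; infimum = λ x y → (λ F → proj₁) , (λ F → proj₂)
                    , λ z p q F a → p F a , q F a }
        ; maximum = λ x F _ → _
        ; minimum = λ x F () }
      ; exponential = λ w x y →
          (λ p F a G q b → p G (⟦⟧-upset w q a , b))
        , (λ p F ab → p F (proj₁ ab) F (⊆-refl {F}) (proj₂ ab)) } }

  emb : Carrier → Term
  emb = gen

module Limit {c ℓ₁ ℓ₂} (ℓ : Level) (A : HeytingAlgebra c ℓ₁ ℓ₂) where

  L : Level
  L = c ⊔ ℓ₂ ⊔ lsuc ℓ

  -- Seq i = A_{i+1}
  Seq : ℕ → HeytingAlgebra c L L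
  Seq zero    = Construction.δ[_] ℓ A
  Seq (suc i) = Construction.δ[_] ℓ (Seq i)

  Car : ℕ → Set c
  Car zero    = HeytingAlgebra.Carrier A
  Car (suc i) = HeytingAlgebra.Carrier (Seq i)

  Eq : ∀ i → Car i → Car i → Set (ℓ₁ ⊔ L)
  Eq zero    x y = Lift (ℓ₁ ⊔ L) (HeytingAlgebra._≈_ A x y)
  Eq (suc i) x y = Lift (ℓ₁ ⊔ L) (HeytingAlgebra._≈_ (Seq i) x y)

  step : ∀ i → Car i → Car (suc i)
  step zero    = Construction.emb ℓ A
  step (suc i) = Construction.emb ℓ (Seq i)

  up : ∀ {i k} → i ≤′ k → Car i → Car k
  up ≤′-refl       x = x
  up {k = suc k} (≤′-step p) x = step k (up p x)

  LimCarrier : Set c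
  LimCarrier = Σ ℕ Car

  _≈∞_ : LimCarrier → LimCarrier → Set (ℓ₁ ⊔ L)
  (i , x) ≈∞ (j , y) =
    ∃ λ k → Σ (i ≤′ k) λ p → Σ (j ≤′ k) λ q → Eq k (up p x) (up q y)

-- Each δ[B] is presented by terms over two copies of the carrier of B, so an
-- enumeration of B induces one of δ[B]: enumerate term shapes with natural
-- numbers at the leaves (via a pairing function ℕ → ℕ × ℕ) and plug in the
-- enumeration of B. By induction every stage A_i is countable, and the direct
-- limit, a quotient of Σ i A_i, is then a countable union of countable sets.
module Submission where

open import Defs
open import Level using (Level; lift)
open import Relation.Binary.Lattice.Bundles using (HeytingAlgebra)
import Relation.Binary.Lattice.Properties.MeetSemilattice as MeetSemilatticeProperties
import Relation.Binary.Lattice.Properties.JoinSemilattice as JoinSemilatticeProperties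
import Relation.Binary.Lattice.Properties.HeytingAlgebra as HeytingAlgebraProperties
open import Data.Nat.Base using (ℕ; zero; suc; _+_; _⊔_; _≤_; s≤s; ≤′-refl)
open import Data.Nat.Properties using (+-identityʳ; +-suc; ≤-refl; m⊔n≤o⇒m≤o; m⊔n≤o⇒n≤o)
open import Data.Product.Base using (∃; ∃₂; _×_; _,_; proj₁; proj₂)
open import Relation.Binary.PropositionalEquality using (_≡_; refl; cong; sym; subst; module ≡-Reasoning)

-- walks each antidiagonal a + b = s from (s , 0) to (0 , s)
next : ℕ × ℕ → ℕ × ℕ
next (zero  , b) = suc b , 0
next (suc a , b) = a , suc b

unpair : ℕ → ℕ × ℕ
unpair zero    = 0 , 0
unpair (suc n) = next (unpair n)

Reached : ℕ × ℕ → Set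
Reached p = ∃ λ n → unpair n ≡ p

reached-next : ∀ {p} → Reached p → Reached (next p)
reached-next (n , e) = suc n , cong next e

reached-along-antidiagonal : ∀ a b → Reached (b + a , 0) → Reached (a , b)
reached-along-antidiagonal a zero    r = r
reached-along-antidiagonal a (suc b) r = reached-next
  (reached-along-antidiagonal (suc a) b (subst (λ s → Reached (s , 0)) (sym (+-suc b a)) r))

reached-start-of-antidiagonal : ∀ s → Reached (s , 0)
reached-start-of-antidiagonal zero    = 0 , refl
reached-start-of-antidiagonal (suc s) = reached-next (reached-along-antidiagonal 0 s
  (subst (λ t → Reached (t , 0)) (sym (+-identityʳ s)) (reached-start-of-antidiagonal s)))

unpair-surjective : ∀ p → Reached p
unpair-surjective (a , b) = reached-along-antidiagonal a b (reached-start-of-antidiagonal (b + a))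

countable-⋃ : ∀ {a r} {A : Set a} (_≈_ : A → A → Set r) (enum : ℕ → ℕ → A) →
              (∀ x → ∃₂ λ i n → enum i n ≈ x) → Countable _≈_
countable-⋃ _≈_ enum covers =
  (λ m → enum (proj₁ (unpair m)) (proj₂ (unpair m))) , onto
  where
  onto : ∀ x → ∃ λ m → enum (proj₁ (unpair m)) (proj₂ (unpair m)) ≈ x
  onto x with covers x
  ... | i , n , e with unpair-surjective (i , n)
  ... | m , refl = m , e

data Code : Set where
  gen dgen          : ℕ → Code
  top bot           : Code
  _and_ _or_ _imp_  : Code → Code → Code

depth : Code → ℕ
depth (s and t) = suc (depth s ⊔ depth t)
depth (s or t)  = suc (depth s ⊔ depth t)
depth (s imp t) = suc (depth s ⊔ depth t)
depth _         = 0

-- decode (suc f) reaches every code of depth ≤ f; the first component of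
-- unpair c is a constructor tag, the second the payload.
mutual
  decode : ℕ → ℕ → Code
  decode zero    _ = top
  decode (suc f) c = decodeNode f (unpair c)

  decodeNode : ℕ → ℕ × ℕ → Code
  decodeNode f (0 , r) = gen r
  decodeNode f (1 , r) = dgen r
  decodeNode f (2 , _) = top
  decodeNode f (3 , _) = bot
  decodeNode f (4 , r) = decode f (proj₁ (unpair r)) and decode f (proj₂ (unpair r))
  decodeNode f (5 , r) = decode f (proj₁ (unpair r)) or  decode f (proj₂ (unpair r))
  decodeNode f (6 , r) = decode f (proj₁ (unpair r)) imp decode f (proj₂ (unpair r))
  decodeNode f _       = top

decodeNode-reached : ∀ f p → ∃ λ c → decode (suc f) c ≡ decodeNode f p
decodeNode-reached f p with unpair-surjective p
... | c , e = c , cong (decodeNode f) e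

decode-binary : (_∙_ : Code → Code → Code) (tag f : ℕ) →
  (∀ r → decodeNode f (tag , r) ≡ decode f (proj₁ (unpair r)) ∙ decode f (proj₂ (unpair r))) →
  ∀ {s t} → (∃ λ c → decode f c ≡ s) → (∃ λ c → decode f c ≡ t) →
  ∃ λ c → decode (suc f) c ≡ s ∙ t
decode-binary _∙_ tag f node-eq (cs , refl) (ct , refl) with unpair-surjective (cs , ct)
... | r , r↦cs,ct with decodeNode-reached f (tag , r)
... | c , c↦r = c , (begin
  decode (suc f) c                                            ≡⟨ c↦r ⟩
  decodeNode f (tag , r)                                      ≡⟨ node-eq r ⟩
  decode f (proj₁ (unpair r)) ∙ decode f (proj₂ (unpair r))   ≡⟨ cong (λ p → decode f (proj₁ p) ∙ decode f (proj₂ p)) r↦cs,ct ⟩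
  decode f cs ∙ decode f ct                                   ∎)
  where open ≡-Reasoning

decode-complete : ∀ s f → depth s ≤ f → ∃ λ c → decode (suc f) c ≡ s
decode-complete (gen n)   f _ = decodeNode-reached f (0 , n)
decode-complete (dgen n)  f _ = decodeNode-reached f (1 , n)
decode-complete top       f _ = decodeNode-reached f (2 , 0)
decode-complete bot       f _ = decodeNode-reached f (3 , 0)
decode-complete (s and t) (suc f) (s≤s d) = decode-binary _and_ 4 (suc f) (λ _ → refl)
  (decode-complete s f (m⊔n≤o⇒m≤o _ _ d))
  (decode-complete t f (m⊔n≤o⇒n≤o _ _ d))
decode-complete (s or t)  (suc f) (s≤s d) = decode-binary _or_  5 (suc f) (λ _ → refl)
  (decode-complete s f (m⊔n≤o⇒m≤o _ _ d))
  (decode-complete t f (m⊔n≤o⇒n≤o _ _ d))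
decode-complete (s imp t) (suc f) (s≤s d) = decode-binary _imp_ 6 (suc f) (λ _ → refl)
  (decode-complete s f (m⊔n≤o⇒m≤o _ _ d))
  (decode-complete t f (m⊔n≤o⇒n≤o _ _ d))

Code-countable : Countable (_≡_ {A = Code})
Code-countable = countable-⋃ _≡_ (λ f → decode (suc f)) λ s →
  let c , e = decode-complete s (depth s) ≤-refl in depth s , c , e

module _ {c ℓ₁ ℓ₂} (ℓ : Level) (B : HeytingAlgebra c ℓ₁ ℓ₂) where
  open HeytingAlgebra B
  open Construction ℓ B
  private
    module δB = HeytingAlgebra δ[_]
  open MeetSemilatticeProperties δB.meetSemilattice using (∧-cong)
  open JoinSemilatticeProperties δB.joinSemilattice using (∨-cong)
  open HeytingAlgebraProperties δ[_] using (⇨-cong)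

  h-cong : ∀ {x y} → x ≈ y → h x ≐ h y
  h-cong x≈y F = (λ (lift m) → lift (upward F (reflexive x≈y) m))
               , (λ (lift m) → lift (upward F (reflexive (Eq.sym x≈y)) m))

  δ-cong : ∀ {X Y} → X ≐ Y → δ X ≐ δ Y
  δ-cong X≐Y F = (λ d F′ F⊊F′ → proj₁ (X≐Y F′) (d F′ F⊊F′))
               , (λ d F′ F⊊F′ → proj₂ (X≐Y F′) (d F′ F⊊F′))

  instantiate : (ℕ → Carrier) → Code → Term
  instantiate e (gen n)   = gen (e n)
  instantiate e (dgen n)  = dgen (e n)
  instantiate e top       = top
  instantiate e bot       = bot
  instantiate e (s and t) = instantiate e s and instantiate e t
  instantiate e (s or t)  = instantiate e s or instantiate e t
  instantiate e (s imp t) = instantiate e s imp instantiate e t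

  instantiate-onto : (e : ℕ → Carrier) → (∀ x → ∃ λ n → e n ≈ x) →
                     ∀ t → ∃ λ s → instantiate e s δB.≈ t
  instantiate-onto e onto = go
    where
    go : ∀ t → ∃ λ s → instantiate e s δB.≈ t
    go (gen x)   = let n , p = onto x in gen n , h-cong p
    go (dgen x)  = let n , p = onto x in dgen n , δ-cong (h-cong p)
    go top       = top , δB.Eq.refl {top}
    go bot       = bot , δB.Eq.refl {bot}
    go (s and t) = let s′ , p = go s ; t′ , q = go t in s′ and t′ ,
                   ∧-cong {instantiate e s′} {s} {instantiate e t′} {t} p q
    go (s or t)  = let s′ , p = go s ; t′ , q = go t in s′ or t′ ,
                   ∨-cong {instantiate e s′} {s} {instantiate e t′} {t} p q
    go (s imp t) = let s′ , p = go s ; t′ , q = go t in s′ imp t′ ,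
                   ⇨-cong {instantiate e s′} {s} {instantiate e t′} {t} p q

  δ-countable : Countable _≈_ → Countable δB._≈_
  δ-countable (e , onto) = (λ n → instantiate e (enum n)) , onto′
    where
    enum : ℕ → Code
    enum = proj₁ Code-countable
    onto′ : ∀ t → ∃ λ n → instantiate e (enum n) δB.≈ t
    onto′ t with instantiate-onto e onto t
    ... | s , p with proj₂ Code-countable s
    ... | n , refl = n , p

propositionP : ∀ {c ℓ₁ ℓ₂} (ℓ : Level) (A : HeytingAlgebra c ℓ₁ ℓ₂) →
    Countable (HeytingAlgebra._≈_ A) →
    Countable (Limit._≈∞_ ℓ A)
propositionP ℓ A (e , onto) = countable-⋃ _≈∞_ (λ i n → i , enum i n) λ (i , x) →
  let n , p = enum-onto i x in i , n , i , ≤′-refl , ≤′-refl , p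
  where
  open Limit ℓ A

  Seq-countable : ∀ i → Countable (HeytingAlgebra._≈_ (Seq i))
  Seq-countable zero    = δ-countable ℓ A (e , onto)
  Seq-countable (suc i) = δ-countable ℓ (Seq i) (Seq-countable i)

  enum : ∀ i → ℕ → Car i
  enum zero    = e
  enum (suc i) = proj₁ (Seq-countable i)

  enum-onto : ∀ i x → ∃ λ n → Eq i (enum i n) x
  enum-onto zero    x = let n , p = onto x in n , lift p
  enum-onto (suc i) x = let n , p = proj₂ (Seq-countable i) x in n , lift p
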